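{- Let $\mathbf A$ be a finite hoop and let $F$ be a filter of $\mathbf A$. For each class $X\in\mathbf A/F$ let $t_X$ be the greatest and $l_X$ the least element of $X$, and let $l$ be the least element of $F$. Then for all $X,Y\in\mathbf A/F$: (i) $t_X\bullet t_Y\leq t_{X\bullet Y}$ for each operation $\bullet\in\{\vee,\wedge,\cdot,\rightarrow\}$; (ii) $X\leq Y$ if and only if $t_X\leq t_Y$; (iii) $t_X\wedge t_Y=t_{X\wedge Y}$; (iv) $t_X\rightarrow t_Y=t_{X\rightarrow Y}$; (v) $t_X\cdot t_{X\rightarrow Y}=t_{X\wedge Y}$; (vi) $a\rightarrow t_X=t_X$ and $t_X\cdot a=t_X\wedge a$ for every $a\in F$; (vii) $t_X\cdot l=t_X\wedge l=l_X$.
   Context: A hoop is an algebra $\mathbf A=(A;\cdot,\rightarrow,1)$ of type $\langle 2,2,0\rangle$ such that $(A;\cdot,1)$ is a commutative monoid and the identities $x\rightarrow x=1$, $(x\cdot y)\rightarrow z=x\rightarrow(y\rightarrow z)$ and $x\cdot(x\rightarrow y)=y\cdot(y\rightarrow x)$ hold. The order is $x\leq y$ iff $x\rightarrow y=1$; infima exist ($x\wedge y=x\cdot(x\rightarrow y)$), and in a finite hoop suprema $\vee$ also exist and the induced lattice is distributive. A filter of $\mathbf A$ is a nonempty $F\subseteq A$ that is upward closed and closed under $\cdot$. It induces the congruence $\theta_F=\{(x,y)\mid (x\rightarrow y)\cdot(y\rightarrow x)\in F\}$, and $\mathbf A/F$ denotes the quotient hoop $\mathbf A/\theta_F$, whose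 elements are the congruence classes, ordered by the hoop order of the quotient. -}

module Defs where

open import Data.Nat using (ℕ)
open import Data.Fin using (Fin)
open import Data.Product using (Σ; _×_; ∃)
open import Function.Bundles using (_↔_)
open import Relation.Binary.PropositionalEquality using (_≡_)

record Hoop : Set₁ where
  infixl 7 _·_
  infixr 5 _⇒_
  field
    Carrier : Set
    _·_     : Carrier → Carrier → Carrier
    _⇒_     : Carrier → Carrier → Carrier
    one     : Carrier
    ·-assoc   : ∀ x y z → (x · y) · z ≡ x · (y · z)
    ·-comm    : ∀ x y → x · y ≡ y · x
    ·-identityˡ : ∀ x → one · x ≡ x
    ⇒-refl    : ∀ x → x ⇒ x ≡ one
    ⇒-curry   : ∀ x y z → (x · y) ⇒ z ≡ x ⇒ (y ⇒ z)
    divisibility : ∀ x y → x · (x ⇒ y) ≡ y · (y ⇒ x)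

module HoopNotions (H : Hoop) where
  open Hoop H public

  infix 4 _≤_
  infixl 6 _∧_

  _≤_ : Carrier → Carrier → Set
  x ≤ y = x ⇒ y ≡ one

  _∧_ : Carrier → Carrier → Carrier
  x ∧ y = x · (x ⇒ y)

  IsSup : Carrier → Carrier → Carrier → Set
  IsSup x y z = x ≤ z × y ≤ z × (∀ w → x ≤ w → y ≤ w → z ≤ w)

  Finite : Set
  Finite = Σ ℕ λ n → Fin n ↔ Carrier

  record IsFilter (F : Carrier → Set) : Set where
    field
      nonempty : ∃ λ x → F x
      upward   : ∀ x y → F x → x ≤ y → F y
      ·-closed : ∀ x y → F x → F y → F (x · y)

  θ : (Carrier → Set) → Carrier → Carrier → Set
  θ F x y = F ((x ⇒ y) · (y ⇒ x))

  -- The quotient A/F: the class X of a is represented by a. Its operations are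
  -- [a]·[b] = [a·b], [a]→[b] = [a→b], [a]∧[b] = [a∧b], unit [1], and its order is
  -- the hoop order of the quotient: [a] ≤ [b] iff [a]→[b] = [1], i.e. (a→b) θ_F 1.
  _≤Q[_]_ : Carrier → (Carrier → Set) → Carrier → Set
  a ≤Q[ F ] b = θ F (a ⇒ b) one

  IsSupQ : (Carrier → Set) → Carrier → Carrier → Carrier → Set
  IsSupQ F a b w = a ≤Q[ F ] w × b ≤Q[ F ] w
                 × (∀ v → a ≤Q[ F ] v → b ≤Q[ F ] v → w ≤Q[ F ] v)

  IsGreatestInClass : (Carrier → Set) → Carrier → Carrier → Set
  IsGreatestInClass F a g = θ F g a × (∀ b → θ F b a → b ≤ g)

  IsLeastInClass : (Carrier → Set) → Carrier → Carrier → Set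
  IsLeastInClass F a m = θ F m a × (∀ b → θ F b a → m ≤ b)

  IsLeastOf : (Carrier → Set) → Carrier → Set
  IsLeastOf F l = F l × (∀ b → F b → l ≤ b)

{-# OPTIONS --safe #-}
-- Write x ≼ y for x → y ∈ F and x ∼ y for x ≼ y ≼ x; then θ_F is ∼ and ∼ is a
-- congruence, so t_X ∙ t_Y ∼ X ∙ Y lies below t_{X∙Y}: (i) for ∧, · and →. The key
-- observation is that for c ∈ F the element c → t_X is in the class of 1 → t_X = t_X,
-- so c → t_X = t_X by maximality (vi). Hence x ≼ t_X already gives
-- x ≤ (x → t_X) → t_X = t_X, which turns ≼ between classes into ≤ between their tops
-- (ii) and yields (i) for ∨. Then (iii) and (iv) follow from (i) and monotonicity of t,
-- (v) from them, and (vii) from t_X · l ∼ t_X and l ≤ t_X → l_X.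
module Submission where

open import Defs
open import Data.Product using (_×_; _,_; proj₁; proj₂)
open import Function.Bundles using (_⇔_; mk⇔; Equivalence)
open import Function.Properties.Equivalence using () renaming (trans to ⇔-trans)
open import Level using (0ℓ)
open import Relation.Binary.Bundles using (Poset)
open import Relation.Binary.Structures using (IsPartialOrder)
open import Relation.Binary.PropositionalEquality
  using (_≡_; refl; sym; trans; cong; cong₂; subst; isEquivalence; module ≡-Reasoning)
import Relation.Binary.Reasoning.PartialOrder as PartialOrderReasoning

module HoopProperties (H : Hoop) where
  open HoopNotions H

  ·-identityʳ : ∀ x → x · one ≡ x
  ·-identityʳ x = trans (·-comm x one) (·-identityˡ x)

  ∧-comm : ∀ x y → x ∧ y ≡ y ∧ x
  ∧-comm = divisibility

  ⇒-identityˡ : ∀ x → one ⇒ x ≡ x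
  ⇒-identityˡ x = begin
      one ⇒ x                  ≡⟨ u≡x·v ⟩
      x · v                    ≡⟨ cong (x ·_) (sym v·[v⇒one]≡v) ⟩
      x · (v · (v ⇒ one))      ≡⟨ sym (·-assoc x v (v ⇒ one)) ⟩
      (x · v) · (v ⇒ one)      ≡⟨ cong₂ _·_ (sym u≡x·v) (sym u⇒x≡v⇒one) ⟩
      (one ⇒ x) · (u ⇒ x)      ≡⟨ ∧-comm u x ⟩
      x · (x ⇒ u)              ≡⟨ cong (x ·_) x⇒u≡one ⟩
      x · one                  ≡⟨ ·-identityʳ x ⟩
      x                        ∎
    where
    open ≡-Reasoning
    u v : Carrier
    u = one ⇒ x
    v = x ⇒ one
    u≡x·v : u ≡ x · v
    u≡x·v = trans (sym (·-identityˡ u)) (∧-comm one x)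
    x⇒u≡one : x ⇒ u ≡ one
    x⇒u≡one = trans (sym (⇒-curry x one x)) (trans (cong (_⇒ x) (·-identityʳ x)) (⇒-refl x))
    u⇒x≡v⇒one : u ⇒ x ≡ v ⇒ one
    u⇒x≡v⇒one = trans (cong (_⇒ x) (trans u≡x·v (·-comm x v)))
                      (trans (⇒-curry v x x) (cong (v ⇒_) (⇒-refl x)))
    v·[v⇒one]≡v : v · (v ⇒ one) ≡ v
    v·[v⇒one]≡v = trans (∧-comm v one)
                  (trans (·-identityˡ (one ⇒ v))
                  (trans (sym (⇒-curry one x one)) (cong (_⇒ one) (·-identityˡ x))))

  x≤one : ∀ x → x ≤ one
  x≤one x = begin
      x ⇒ one                    ≡⟨ cong (_⇒ one) (sym x·[x⇒one]≡x) ⟩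
      (x · (x ⇒ one)) ⇒ one      ≡⟨ cong (_⇒ one) (·-comm x (x ⇒ one)) ⟩
      ((x ⇒ one) · x) ⇒ one      ≡⟨ ⇒-curry (x ⇒ one) x one ⟩
      (x ⇒ one) ⇒ (x ⇒ one)      ≡⟨ ⇒-refl (x ⇒ one) ⟩
      one                        ∎
    where
    open ≡-Reasoning
    x·[x⇒one]≡x : x · (x ⇒ one) ≡ x
    x·[x⇒one]≡x = trans (∧-comm x one) (trans (·-identityˡ (one ⇒ x)) (⇒-identityˡ x))

  ≤-reflexive : ∀ {x y} → x ≡ y → x ≤ y
  ≤-reflexive {x} refl = ⇒-refl x

  x≤y⇒x∧y≡x : ∀ {x y} → x ≤ y → x ∧ y ≡ x
  x≤y⇒x∧y≡x {x} x≤y = trans (cong (x ·_) x≤y) (·-identityʳ x)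

  ≤-antisym : ∀ {x y} → x ≤ y → y ≤ x → x ≡ y
  ≤-antisym {x} {y} x≤y y≤x =
    trans (sym (x≤y⇒x∧y≡x x≤y)) (trans (∧-comm x y) (x≤y⇒x∧y≡x y≤x))

  ≤-trans : ∀ {x y z} → x ≤ y → y ≤ z → x ≤ z
  ≤-trans {x} {y} {z} x≤y y≤z = begin
      x ⇒ z                  ≡⟨ cong (_⇒ z) (sym (trans (∧-comm y x) (x≤y⇒x∧y≡x x≤y))) ⟩
      (y · (y ⇒ x)) ⇒ z      ≡⟨ cong (_⇒ z) (·-comm y (y ⇒ x)) ⟩
      ((y ⇒ x) · y) ⇒ z      ≡⟨ ⇒-curry (y ⇒ x) y z ⟩
      (y ⇒ x) ⇒ (y ⇒ z)      ≡⟨ cong ((y ⇒ x) ⇒_) y≤z ⟩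
      (y ⇒ x) ⇒ one          ≡⟨ x≤one (y ⇒ x) ⟩
      one                    ∎
    where open ≡-Reasoning

  ≤-isPartialOrder : IsPartialOrder _≡_ _≤_
  ≤-isPartialOrder = record
    { isPreorder = record
      { isEquivalence = isEquivalence
      ; reflexive     = ≤-reflexive
      ; trans         = ≤-trans
      }
    ; antisym = ≤-antisym
    }

  ≤-poset : Poset 0ℓ 0ℓ 0ℓ
  ≤-poset = record { isPartialOrder = ≤-isPartialOrder }

  module ≤-Reasoning = PartialOrderReasoning ≤-poset

  ≤-curry : ∀ {x y z} → x · y ≤ z → x ≤ y ⇒ z
  ≤-curry {x} {y} {z} = trans (sym (⇒-curry x y z))

  ≤-uncurry : ∀ {x y z} → x ≤ y ⇒ z → x · y ≤ z
  ≤-uncurry {x} {y} {z} = trans (⇒-curry x y z)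

  x·y≤x : ∀ x y → x · y ≤ x
  x·y≤x x y = begin
      (x · y) ⇒ x    ≡⟨ cong (_⇒ x) (·-comm x y) ⟩
      (y · x) ⇒ x    ≡⟨ ⇒-curry y x x ⟩
      y ⇒ (x ⇒ x)    ≡⟨ cong (y ⇒_) (⇒-refl x) ⟩
      y ⇒ one        ≡⟨ x≤one y ⟩
      one            ∎
    where open ≡-Reasoning

  x·y≤y : ∀ x y → x · y ≤ y
  x·y≤y x y = ≤-trans (≤-reflexive (·-comm x y)) (x·y≤x y x)

  x·[x⇒y]≤y : ∀ x y → x · (x ⇒ y) ≤ y
  x·[x⇒y]≤y x y =
    trans (cong (_⇒ y) (·-comm x (x ⇒ y))) (trans (⇒-curry (x ⇒ y) x y) (⇒-refl (x ⇒ y)))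

  ·-monoˡ-≤ : ∀ {x y} z → x ≤ y → x · z ≤ y · z
  ·-monoˡ-≤ {y = y} z x≤y = ≤-uncurry (≤-trans x≤y (≤-curry (≤-reflexive {y · z} refl)))

  ·-monoʳ-≤ : ∀ {x y} z → x ≤ y → z · x ≤ z · y
  ·-monoʳ-≤ {x} {y} z x≤y = begin
      z · x    ≡⟨ ·-comm z x ⟩
      x · z    ≤⟨ ·-monoˡ-≤ z x≤y ⟩
      y · z    ≡⟨ ·-comm y z ⟩
      z · y    ∎
    where open ≤-Reasoning

  ⇒-monoʳ-≤ : ∀ {y z} x → y ≤ z → x ⇒ y ≤ x ⇒ z
  ⇒-monoʳ-≤ {y} {z} x y≤z = ≤-curry (begin
      (x ⇒ y) · x    ≡⟨ ·-comm (x ⇒ y) x ⟩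
      x · (x ⇒ y)    ≤⟨ x·[x⇒y]≤y x y ⟩
      y              ≤⟨ y≤z ⟩
      z              ∎)
    where open ≤-Reasoning

  y≤x⇒y : ∀ x y → y ≤ x ⇒ y
  y≤x⇒y x y = ≤-curry (x·y≤x y x)

  x≤[x⇒y]⇒y : ∀ x y → x ≤ (x ⇒ y) ⇒ y
  x≤[x⇒y]⇒y x y = ≤-curry (x·[x⇒y]≤y x y)

  ∧-greatest : ∀ {x y z} → x ≤ y → x ≤ z → x ≤ y ∧ z
  ∧-greatest {x} {y} {z} x≤y x≤z = begin
      x              ≡⟨ sym (trans (∧-comm y x) (x≤y⇒x∧y≡x x≤y)) ⟩
      y · (y ⇒ x)    ≤⟨ ·-monoʳ-≤ y (⇒-monoʳ-≤ y x≤z) ⟩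
      y · (y ⇒ z)    ∎
    where open ≤-Reasoning

  [x⇒y]·[y⇒z]≤x⇒z : ∀ x y z → (x ⇒ y) · (y ⇒ z) ≤ x ⇒ z
  [x⇒y]·[y⇒z]≤x⇒z x y z = ≤-curry (begin
      ((x ⇒ y) · (y ⇒ z)) · x    ≡⟨ ·-comm _ x ⟩
      x · ((x ⇒ y) · (y ⇒ z))    ≡⟨ sym (·-assoc x (x ⇒ y) (y ⇒ z)) ⟩
      (x · (x ⇒ y)) · (y ⇒ z)    ≤⟨ ·-monoˡ-≤ (y ⇒ z) (x·[x⇒y]≤y x y) ⟩
      y · (y ⇒ z)                ≤⟨ x·[x⇒y]≤y y z ⟩
      z                          ∎)
    where open ≤-Reasoning

  x⇒y≤[x·z]⇒[y·z] : ∀ x y z → x ⇒ y ≤ (x · z) ⇒ (y · z)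
  x⇒y≤[x·z]⇒[y·z] x y z = ≤-curry (begin
      (x ⇒ y) · (x · z)    ≡⟨ sym (·-assoc (x ⇒ y) x z) ⟩
      ((x ⇒ y) · x) · z    ≡⟨ cong (_· z) (·-comm (x ⇒ y) x) ⟩
      (x · (x ⇒ y)) · z    ≤⟨ ·-monoˡ-≤ z (x·[x⇒y]≤y x y) ⟩
      y · z                ∎)
    where open ≤-Reasoning

  y⇒z≤[x⇒y]⇒[x⇒z] : ∀ x y z → y ⇒ z ≤ (x ⇒ y) ⇒ (x ⇒ z)
  y⇒z≤[x⇒y]⇒[x⇒z] x y z =
    ≤-curry (≤-trans (≤-reflexive (·-comm (y ⇒ z) (x ⇒ y))) ([x⇒y]·[y⇒z]≤x⇒z x y z))

  y⇒x≤[x⇒z]⇒[y⇒z] : ∀ x y z → y ⇒ x ≤ (x ⇒ z) ⇒ (y ⇒ z)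
  y⇒x≤[x⇒z]⇒[y⇒z] x y z = ≤-curry ([x⇒y]·[y⇒z]≤x⇒z y x z)

module FilterCongruence (H : Hoop) {F : HoopNotions.Carrier H → Set}
                        (isFilter : HoopNotions.IsFilter H F) where
  open HoopNotions H
  open HoopProperties H
  open IsFilter isFilter

  infix 4 _≼_ _∼_

  _≼_ : Carrier → Carrier → Set
  x ≼ y = F (x ⇒ y)

  _∼_ : Carrier → Carrier → Set
  x ∼ y = x ≼ y × y ≼ x

  one∈F : F one
  one∈F = upward _ one (proj₂ nonempty) (x≤one _)

  ≤⇒≼ : ∀ {x y} → x ≤ y → x ≼ y
  ≤⇒≼ x≤y = subst F (sym x≤y) one∈F

  ≼-trans : ∀ {x y z} → x ≼ y → y ≼ z → x ≼ z
  ≼-trans {x} {y} {z} x≼y y≼z =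
    upward _ (x ⇒ z) (·-closed _ _ x≼y y≼z) ([x⇒y]·[y⇒z]≤x⇒z x y z)

  ·-monoˡ-≼ : ∀ {x y} z → x ≼ y → x · z ≼ y · z
  ·-monoˡ-≼ {x} {y} z x≼y = upward _ _ x≼y (x⇒y≤[x·z]⇒[y·z] x y z)

  ⇒-monoʳ-≼ : ∀ {y z} x → y ≼ z → x ⇒ y ≼ x ⇒ z
  ⇒-monoʳ-≼ {y} {z} x y≼z = upward _ _ y≼z (y⇒z≤[x⇒y]⇒[x⇒z] x y z)

  ⇒-antiˡ-≼ : ∀ {x y} z → y ≼ x → x ⇒ z ≼ y ⇒ z
  ⇒-antiˡ-≼ {x} {y} z y≼x = upward _ _ y≼x (y⇒x≤[x⇒z]⇒[y⇒z] x y z)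

  ≤Q⇔≼ : ∀ {x y} → x ≤Q[ F ] y ⇔ x ≼ y
  ≤Q⇔≼ {x} {y} = mk⇔
    (λ θ[x⇒y,one] → subst F (⇒-identityˡ (x ⇒ y)) (upward _ _ θ[x⇒y,one] (x·y≤y _ _)))
    (λ x≼y → ·-closed _ _ (≤⇒≼ (x≤one (x ⇒ y))) (subst F (sym (⇒-identityˡ (x ⇒ y))) x≼y))

  θ⇒∼ : ∀ {x y} → θ F x y → x ∼ y
  θ⇒∼ {x} {y} θxy =
    upward _ _ θxy (x·y≤x (x ⇒ y) (y ⇒ x)) ,
    upward _ _ θxy (x·y≤y (x ⇒ y) (y ⇒ x))

  ∼⇒θ : ∀ {x y} → x ∼ y → θ F x y
  ∼⇒θ (x≼y , y≼x) = ·-closed _ _ x≼y y≼x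

  ∼-reflexive : ∀ {x y} → x ≡ y → x ∼ y
  ∼-reflexive x≡y = ≤⇒≼ (≤-reflexive x≡y) , ≤⇒≼ (≤-reflexive (sym x≡y))

  ∼-refl : ∀ {x} → x ∼ x
  ∼-refl = ∼-reflexive refl

  ∼-sym : ∀ {x y} → x ∼ y → y ∼ x
  ∼-sym (x≼y , y≼x) = y≼x , x≼y

  ∼-trans : ∀ {x y z} → x ∼ y → y ∼ z → x ∼ z
  ∼-trans (x≼y , y≼x) (y≼z , z≼y) = ≼-trans x≼y y≼z , ≼-trans z≼y y≼x

  ∈F⇒∼one : ∀ {x} → F x → x ∼ one
  ∈F⇒∼one {x} x∈F = ≤⇒≼ (x≤one x) , subst F (sym (⇒-identityˡ x)) x∈F

  ·-cong : ∀ {x x' y y'} → x ∼ x' → y ∼ y' → x · y ∼ x' · y'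
  ·-cong {x' = x'} {y = y} x∼x' y∼y' = ∼-trans (·-congʳ y x∼x') (·-congˡ x' y∼y')
    where
    ·-congʳ : ∀ {u u'} w → u ∼ u' → u · w ∼ u' · w
    ·-congʳ w (u≼u' , u'≼u) = ·-monoˡ-≼ w u≼u' , ·-monoˡ-≼ w u'≼u
    ·-congˡ : ∀ {u u'} w → u ∼ u' → w · u ∼ w · u'
    ·-congˡ {u} {u'} w u∼u' =
      ∼-trans (∼-reflexive (·-comm w u)) (∼-trans (·-congʳ w u∼u') (∼-reflexive (·-comm u' w)))

  ⇒-cong : ∀ {x x' y y'} → x ∼ x' → y ∼ y' → x ⇒ y ∼ x' ⇒ y'
  ⇒-cong {x} {x'} {y} {y'} (x≼x' , x'≼x) (y≼y' , y'≼y) =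
    ≼-trans (⇒-antiˡ-≼ y x'≼x) (⇒-monoʳ-≼ x' y≼y') ,
    ≼-trans (⇒-antiˡ-≼ y' x≼x') (⇒-monoʳ-≼ x y'≼y)

  ∧-cong : ∀ {x x' y y'} → x ∼ x' → y ∼ y' → x ∧ y ∼ x' ∧ y'
  ∧-cong x∼x' y∼y' = ·-cong x∼x' (⇒-cong x∼x' y∼y')

module GreatestInClass (H : Hoop) {F : HoopNotions.Carrier H → Set}
                       (isFilter : HoopNotions.IsFilter H F)
                       (t : HoopNotions.Carrier H → HoopNotions.Carrier H)
                       (t-greatest : ∀ a → HoopNotions.IsGreatestInClass H F a (t a)) where
  open HoopNotions H
  open HoopProperties H
  open FilterCongruence H isFilter

  t∼ : ∀ a → t a ∼ a
  t∼ a = θ⇒∼ (proj₁ (t-greatest a))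

  ∼⇒≤t : ∀ {x a} → x ∼ a → x ≤ t a
  ∼⇒≤t {x} {a} x∼a = proj₂ (t-greatest a) x (∼⇒θ x∼a)

  ∈F⇒[c⇒t]≡t : ∀ {c} a → F c → c ⇒ t a ≡ t a
  ∈F⇒[c⇒t]≡t {c} a c∈F = ≤-antisym
    (∼⇒≤t (∼-trans (⇒-cong (∈F⇒∼one c∈F) (t∼ a)) (∼-reflexive (⇒-identityˡ a))))
    (y≤x⇒y c (t a))

  ≼t⇒≤t : ∀ {x} a → x ≼ t a → x ≤ t a
  ≼t⇒≤t {x} a x≼ta = begin
      x                  ≤⟨ x≤[x⇒y]⇒y x (t a) ⟩
      (x ⇒ t a) ⇒ t a    ≡⟨ ∈F⇒[c⇒t]≡t a x≼ta ⟩
      t a                ∎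
    where open ≤-Reasoning

  ≼⇔t≤t : ∀ {a b} → a ≼ b ⇔ t a ≤ t b
  ≼⇔t≤t {a} {b} = mk⇔
    (λ a≼b → ≼t⇒≤t b (≼-trans (proj₁ (t∼ a)) (≼-trans a≼b (proj₂ (t∼ b)))))
    (λ ta≤tb → ≼-trans (proj₂ (t∼ a)) (≼-trans (≤⇒≼ ta≤tb) (proj₁ (t∼ b))))

  t-mono-≤ : ∀ {a b} → a ≤ b → t a ≤ t b
  t-mono-≤ a≤b = Equivalence.to ≼⇔t≤t (≤⇒≼ a≤b)

  t∧t≡t[∧] : ∀ a b → t a ∧ t b ≡ t (a ∧ b)
  t∧t≡t[∧] a b = ≤-antisym
    (∼⇒≤t (∧-cong (t∼ a) (t∼ b)))
    (∧-greatest (t-mono-≤ (x·y≤x a (a ⇒ b))) (t-mono-≤ (x·[x⇒y]≤y a b)))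

  t⇒t≡t[⇒] : ∀ a b → t a ⇒ t b ≡ t (a ⇒ b)
  t⇒t≡t[⇒] a b = ≤-antisym (∼⇒≤t (⇒-cong (t∼ a) (t∼ b))) (≤-curry (begin
      t (a ⇒ b) · t a      ≡⟨ ·-comm (t (a ⇒ b)) (t a) ⟩
      t a · t (a ⇒ b)      ≤⟨ ∼⇒≤t (·-cong (t∼ a) (t∼ (a ⇒ b))) ⟩
      t (a · (a ⇒ b))      ≤⟨ t-mono-≤ (x·[x⇒y]≤y a b) ⟩
      t b                  ∎))
    where open ≤-Reasoning

  t·c≡t∧c : ∀ {c} a → F c → t a · c ≡ t a ∧ c
  t·c≡t∧c {c} a c∈F = begin
      t a · c              ≡⟨ ·-comm (t a) c ⟩
      c · t a              ≡⟨ cong (c ·_) (∈F⇒[c⇒t]≡t a c∈F) ⟨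
      c · (c ⇒ t a)        ≡⟨ ∧-comm c (t a) ⟩
      t a ∧ c              ∎
    where open ≡-Reasoning

  t∧least≡leastInClass : ∀ {l m} a → IsLeastOf F l → IsLeastInClass F a m → t a ∧ l ≡ m
  t∧least≡leastInClass {l} {m} a (l∈F , l-least) (θma , m-least) = begin
      t a ∧ l    ≡⟨ t·c≡t∧c a l∈F ⟨
      t a · l    ≡⟨ ≤-antisym ta·l≤m (m-least (t a · l) (∼⇒θ ta·l∼a)) ⟩
      m          ∎
    where
    open ≡-Reasoning
    ta·l∼a : t a · l ∼ a
    ta·l∼a = ∼-trans (·-cong ∼-refl (∈F⇒∼one l∈F)) (∼-trans (∼-reflexive (·-identityʳ (t a))) (t∼ a))
    ta·l≤m : t a · l ≤ m
    ta·l≤m = ≤-trans (≤-reflexive (·-comm (t a) l))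
                     (≤-uncurry (l-least (t a ⇒ m) (proj₁ (∼-trans (t∼ a) (∼-sym (θ⇒∼ θma))))))

lemma13 : (H : Hoop) → let open HoopNotions H in
          Finite → (F : Carrier → Set) → IsFilter F →
          (t lo : Carrier → Carrier) →
          (∀ a → IsGreatestInClass F a (t a)) →
          (∀ a → IsLeastInClass F a (lo a)) →
          (l : Carrier) → IsLeastOf F l →
          ∀ a b →
            -- (i)
            ((∀ z w → IsSup (t a) (t b) z → IsSupQ F a b w → z ≤ t w)
             × t a ∧ t b ≤ t (a ∧ b)
             × t a · t b ≤ t (a · b)
             × (t a ⇒ t b) ≤ t (a ⇒ b))
            -- (ii)
            × (a ≤Q[ F ] b ⇔ t a ≤ t b)
            -- (iii)
            × t a ∧ t b ≡ t (a ∧ b)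
            -- (iv)
            × (t a ⇒ t b) ≡ t (a ⇒ b)
            -- (v)
            × t a · t (a ⇒ b) ≡ t (a ∧ b)
            -- (vi)
            × (∀ c → F c → (c ⇒ t a) ≡ t a × t a · c ≡ t a ∧ c)
            -- (vii)
            × (t a · l ≡ t a ∧ l × t a ∧ l ≡ lo a)
-- Finiteness only guarantees that t, lo and l exist; they are given here.
lemma13 H _ F isFilter t lo t-greatest lo-least l l-least a b =
    (sup≤t , ≤-reflexive (t∧t≡t[∧] a b) , ∼⇒≤t (·-cong (t∼ a) (t∼ b)) , ≤-reflexive (t⇒t≡t[⇒] a b))
  , ≤Q⇔t≤t
  , t∧t≡t[∧] a b
  , t⇒t≡t[⇒] a b
  , trans (cong (t a ·_) (sym (t⇒t≡t[⇒] a b))) (t∧t≡t[∧] a b)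
  , (λ c c∈F → ∈F⇒[c⇒t]≡t a c∈F , t·c≡t∧c a c∈F)
  , (t·c≡t∧c a (proj₁ l-least) , t∧least≡leastInClass a l-least (lo-least a))
  where
  open HoopNotions H
  open HoopProperties H
  open FilterCongruence H isFilter
  open GreatestInClass H isFilter t t-greatest

  ≤Q⇔t≤t : ∀ {x y} → x ≤Q[ F ] y ⇔ t x ≤ t y
  ≤Q⇔t≤t = ⇔-trans ≤Q⇔≼ ≼⇔t≤t

  sup≤t : ∀ z w → IsSup (t a) (t b) z → IsSupQ F a b w → z ≤ t w
  sup≤t z w (_ , _ , z-least) (a≤w , b≤w , _) =
    z-least (t w) (Equivalence.to ≤Q⇔t≤t a≤w) (Equivalence.to ≤Q⇔t≤t b≤w)
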